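{- Let $h\ge 4$ and let $G$ be a graph with $\chi(G)=\Gamma(G)=3$, $\psi(G)=h$ and exactly $2h-2$ vertices. Let $\mathcal H$ be a complete $h$-coloring of $G$ having exactly two singleton color classes $\{\phi_1\}$, $\{\phi_2\}$, all other color classes (called pairs) having exactly two vertices. If a maximal stable set $S$ of $G$ contains some pair, then $S$ contains at least one endvertex of every induced path $P_4$ of $G$ whose middle edge is $\phi_1\phi_2$.
   Context: A complete $k$-coloring of a graph is a proper coloring with exactly $k$ colors in which any two color classes are joined by at least one edge; $\psi$ (achromatic number) is the maximum such $k$, $\chi$ is the chromatic number. A Grundy coloring is a proper coloring $\varphi:V\to\{1,\dots,k\}$ in which every vertex $v$ has a neighbor of color $i$ for every $1\le i<\varphi(v)$; the Grundy number $\Gamma$ is the maximum $k$ for which such a coloring exists. A stable set is a set of pairwise nonadjacent vertices. -}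

module Defs where

open import Data.Nat using (ℕ; _<_; _+_; _*_)
open import Data.Fin using (Fin) renaming (_<_ to _<ᶠ_)
open import Data.Fin.Subset using (Subset; _∈_; _⊆_)
open import Data.Product using (Σ; ∃; ∃-syntax; _×_; _,_)
open import Data.Sum using (_⊎_)
open import Data.Empty using (⊥)
open import Relation.Nullary using (¬_)
open import Relation.Binary.PropositionalEquality using (_≡_; _≢_)
open import Function.Definitions using (Surjective)

record Graph (n : ℕ) : Set₁ where
  field
    Adj     : Fin n → Fin n → Set
    sym     : ∀ {u v} → Adj u v → Adj v u
    irrefl  : ∀ {v} → ¬ Adj v v
open Graph public

module _ {n : ℕ} (G : Graph n) where

  Proper : {k : ℕ} → (Fin n → Fin k) → Set
  Proper c = ∀ u v → Adj G u v → c u ≢ c v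

  Onto : {k : ℕ} → (Fin n → Fin k) → Set
  Onto c = Surjective _≡_ _≡_ c

  IsComplete : {k : ℕ} → (Fin n → Fin k) → Set
  IsComplete {k} c = Proper c × Onto c ×
    (∀ (i j : Fin k) → i ≢ j → ∃[ u ] ∃[ v ] (Adj G u v × c u ≡ i × c v ≡ j))

  -- Grundy coloring with colors 0..k-1 (= 1..k), using all k colors
  IsGrundy : {k : ℕ} → (Fin n → Fin k) → Set
  IsGrundy {k} c = Proper c × Onto c ×
    (∀ v (i : Fin k) → i <ᶠ c v → ∃[ u ] (Adj G v u × c u ≡ i))

  ChromaticNumber : ℕ → Set
  ChromaticNumber k = (Σ (Fin n → Fin k) Proper) ×
    (∀ m → m < k → ¬ Σ (Fin n → Fin m) Proper)

  GrundyNumber : ℕ → Set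
  GrundyNumber k = (Σ (Fin n → Fin k) IsGrundy) ×
    (∀ m → k < m → ¬ Σ (Fin n → Fin m) IsGrundy)

  AchromaticNumber : ℕ → Set
  AchromaticNumber k = (Σ (Fin n → Fin k) IsComplete) ×
    (∀ m → k < m → ¬ Σ (Fin n → Fin m) IsComplete)

  Stable : Subset n → Set
  Stable S = ∀ u v → u ∈ S → v ∈ S → ¬ Adj G u v

  MaximalStable : Subset n → Set
  MaximalStable S = Stable S × (∀ T → Stable T → S ⊆ T → T ⊆ S)

  InducedP4 : Fin n → Fin n → Fin n → Fin n → Set
  InducedP4 a x y b =
    a ≢ x × a ≢ y × a ≢ b × x ≢ y × x ≢ b × y ≢ b ×
    Adj G a x × Adj G x y × Adj G y b ×
    ¬ Adj G a y × ¬ Adj G x b × ¬ Adj G a b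

  SingletonClass : {k : ℕ} → (Fin n → Fin k) → Fin n → Set
  SingletonClass c v = ∀ w → c w ≡ c v → w ≡ v

  PairClass : {k : ℕ} → (Fin n → Fin k) → Fin k → Set
  PairClass c i = ∃[ u ] ∃[ v ] (u ≢ v × c u ≡ i × c v ≡ i ×
    (∀ w → c w ≡ i → w ≡ u ⊎ w ≡ v))

-- Suppose a, b ∉ S.  By maximality of S, a and b have neighbours
-- in S; by completeness of the colouring, each singleton φ is joined to
-- the pair class inside S, so x and y have neighbours in S as well.  Now
-- colour S with 0, a and b with 1, x with 2 and y with 3: this is a
-- Grundy colouring of the induced subgraph on S ∪ {a, x, y, b}, and
-- every partial Grundy colouring extends greedily (first-fit) to the
-- whole graph.  The result is a Grundy colouring with at least 4
-- colours, contradicting Γ(G) = 3.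
--
-- Adjacency is not assumed
-- decidable: since the goal reduces to ⊥, decidability of the (finite)
-- adjacency relation may be assumed under a double negation.

module Submission where

open import Defs
open import Data.Nat using (ℕ; _≤_; _+_; _*_)
open import Data.Fin using (Fin)
open import Data.Fin.Subset using (Subset; _∈_)
open import Data.Product using (_×_; ∃-syntax)
open import Data.Sum using (_⊎_)
open import Relation.Binary.PropositionalEquality using (_≡_; _≢_)

open import Data.Nat using (zero; suc; _<_; s≤s; s≤s⁻¹)
import Data.Nat as ℕ
open import Data.Nat.Properties using (m≤n⇒m<n∨m≡n; <-irrefl)
open import Data.Fin using (zero; suc; toℕ; fromℕ; fromℕ<; inject) renaming (_≟_ to _≟ᶠ_; _<_ to _<ᶠ_)
open import Data.Fin.Properties using (any?; toℕ-injective; toℕ-fromℕ; toℕ-fromℕ<; toℕ-inject; toℕ<n; ¬∀⟶∃¬-smallest)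
open import Data.Fin.Subset using (_∪_; ⁅_⁆)
open import Data.Fin.Subset.Properties using (_∈?_; x∈p∪q⁻; x∈p∪q⁺; x∈⁅x⁆; x∈⁅y⁆⇒x≡y; p⊆p∪q)
open import Data.List using (List; []; _∷_; foldr; allFin)
open import Data.List.Relation.Unary.Any using (here; there)
open import Data.List.Relation.Unary.All using (lookup)
open import Data.List.Membership.Propositional using () renaming (_∈_ to _∈ᴸ_)
open import Data.List.Membership.Propositional.Properties using (∈-allFin)
open import Data.List.Extrema.Nat using (argmax; f[xs]≤f[argmax])
open import Data.Product using (Σ; _,_; proj₁; proj₂)
open import Data.Sum using (inj₁; inj₂; [_,_])
open import Data.Unit using (⊤; tt)
open import Data.Empty using (⊥; ⊥-elim)
open import Function using (_∘_; id)
open import Relation.Nullary using (¬_; Dec; yes; no)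
open import Relation.Nullary.Decidable using (_×-dec_; _⊎-dec_; ¬¬-excluded-middle)
open import Relation.Binary.PropositionalEquality using (refl; trans; cong; subst)
import Relation.Binary.PropositionalEquality as ≡

firstFailure : {P : ℕ → Set} → (∀ j → Dec (P j)) → ∀ B → ¬ P B →
  ∃[ m ] (¬ P m × (∀ j → j < m → P j))
firstFailure {P} P? B ¬PB
  with ¬∀⟶∃¬-smallest (suc B) (P ∘ toℕ) (P? ∘ toℕ)
         (λ all → ¬PB (subst P (toℕ-fromℕ B) (all (fromℕ B))))
... | i , ¬Pi , below = toℕ i , ¬Pi , λ j j<i →
  subst P (trans (toℕ-inject (fromℕ< j<i)) (toℕ-fromℕ< j<i)) (below (fromℕ< j<i))

maximiser : ∀ {n} (f : Fin n → ℕ) → Fin n → ∃[ m ] (∀ u → f u ≤ f m)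
maximiser {n} f v₀ =
  argmax f v₀ (allFin n) , λ u → lookup (f[xs]≤f[argmax] v₀ (allFin n)) (∈-allFin u)

-- Double-negation shift over a finite index set; it lets us assume that
-- adjacency is decidable when proving a negative statement.
¬¬-∀Fin : ∀ {n} {P : Fin n → Set} → (∀ i → ¬ ¬ P i) → ¬ ¬ (∀ i → P i)
¬¬-∀Fin {zero} _ k = k (λ ())
¬¬-∀Fin {suc n} h k =
  h zero (λ p₀ → ¬¬-∀Fin (h ∘ suc) (λ ps → k (λ { zero → p₀ ; (suc i) → ps i })))

_[_↦_] : ∀ {n} → (Fin n → ℕ) → Fin n → ℕ → Fin n → ℕ
(col [ v ↦ k ]) u with u ≟ᶠ v
... | yes _ = k
... | no _ = col u

↦-here : ∀ {n} (col : Fin n → ℕ) v k → (col [ v ↦ k ]) v ≡ k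
↦-here col v k with v ≟ᶠ v
... | yes _ = refl
... | no v≢v = ⊥-elim (v≢v refl)

↦-away : ∀ {n} (col : Fin n → ℕ) {v u} k → u ≢ v → (col [ v ↦ k ]) u ≡ col u
↦-away col {v} {u} k u≢v with u ≟ᶠ v
... | yes u≡v = ⊥-elim (u≢v u≡v)
... | no _ = refl

_∷ᴰ_ : ∀ {n} → Fin n → (Fin n → Set) → Fin n → Set
(v ∷ᴰ D) u = u ≡ v ⊎ D u

_∷?_ : ∀ {n} (v : Fin n) {D : Fin n → Set} → (∀ u → Dec (D u)) → ∀ u → Dec ((v ∷ᴰ D) u)
(v ∷? D?) u = (u ≟ᶠ v) ⊎-dec D? u

foldr-dec : ∀ {n} {D : Fin n → Set} → (∀ u → Dec (D u)) → (L : List (Fin n)) →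
  ∀ u → Dec (foldr _∷ᴰ_ D L u)
foldr-dec D? [] = D?
foldr-dec D? (w ∷ L) = w ∷? foldr-dec D? L

foldr-⊇ : ∀ {n} {D : Fin n → Set} (L : List (Fin n)) {u} → D u → foldr _∷ᴰ_ D L u
foldr-⊇ [] Du = Du
foldr-⊇ (w ∷ L) Du = inj₂ (foldr-⊇ L Du)

foldr-∋ : ∀ {n} {D : Fin n → Set} (L : List (Fin n)) {u} → u ∈ᴸ L → foldr _∷ᴰ_ D L u
foldr-∋ (w ∷ L) (here u≡w) = inj₁ u≡w
foldr-∋ (w ∷ L) (there u∈L) = inj₂ (foldr-∋ L u∈L)

module _ {n : ℕ} (G : Graph n) where

  Hits : (Fin n → Set) → (Fin n → ℕ) → Fin n → ℕ → Set
  Hits D col v j = ∃[ u ] (D u × Adj G v u × col u ≡ j)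

  record IsPartialGrundy (D : Fin n → Set) (col : Fin n → ℕ) : Set where
    field
      proper : ∀ u v → D u → D v → Adj G u v → col u ≢ col v
      grundy : ∀ v → D v → ∀ j → j < col v → Hits D col v j
  open IsPartialGrundy

  Agrees : (Fin n → Set) → (Fin n → ℕ) → (Fin n → ℕ) → Set
  Agrees D col col' = ∀ u → D u → col' u ≡ col u

  addVertex : ∀ {D col v k} → IsPartialGrundy D col → ¬ D v →
    (∀ u → D u → Adj G v u → col u ≢ k) → (∀ j → j < k → Hits D col v j) →
    IsPartialGrundy (v ∷ᴰ D) (col [ v ↦ k ])
  addVertex {D} {col} {v} {k} pg v∉D fresh hits = record { proper = proper′ ; grundy = grundy′ }
    where
      keep : ∀ {u} → D u → (col [ v ↦ k ]) u ≡ col u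
      keep Du = ↦-away col k (λ { refl → v∉D Du })

      lift : ∀ {w j} → Hits D col w j → Hits (v ∷ᴰ D) (col [ v ↦ k ]) w j
      lift (u , Du , adj , e) = u , inj₂ Du , adj , trans (keep Du) e

      proper′ : ∀ u w → (v ∷ᴰ D) u → (v ∷ᴰ D) w → Adj G u w →
        (col [ v ↦ k ]) u ≢ (col [ v ↦ k ]) w
      proper′ _ _ (inj₁ refl) (inj₁ refl) adj = ⊥-elim (irrefl G adj)
      proper′ _ w (inj₁ refl) (inj₂ Dw) adj e =
        fresh w Dw adj (trans (≡.sym (keep Dw)) (trans (≡.sym e) (↦-here col v k)))
      proper′ u _ (inj₂ Du) (inj₁ refl) adj e =
        fresh u Du (sym G adj) (trans (≡.sym (keep Du)) (trans e (↦-here col v k)))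
      proper′ u w (inj₂ Du) (inj₂ Dw) adj e =
        proper pg u w Du Dw adj (trans (≡.sym (keep Du)) (trans e (keep Dw)))

      grundy′ : ∀ w → (v ∷ᴰ D) w → ∀ j → j < (col [ v ↦ k ]) w → Hits (v ∷ᴰ D) (col [ v ↦ k ]) w j
      grundy′ _ (inj₁ refl) j lt = lift (hits j (subst (j <_) (↦-here col v k) lt))
      grundy′ w (inj₂ Dw) j lt = lift (grundy pg w Dw j (subst (j <_) (keep Dw) lt))

  absorb : ∀ {D col v} → D v → IsPartialGrundy D col → IsPartialGrundy (v ∷ᴰ D) col
  absorb {D} {col} {v} Dv pg = record
    { proper = λ u w du dw → proper pg u w (shrink du) (shrink dw)
    ; grundy = λ w dw j lt → widen (grundy pg w (shrink dw) j lt) }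
    where
      shrink : ∀ {u} → (v ∷ᴰ D) u → D u
      shrink = [ (λ { refl → Dv }) , id ]
      widen : ∀ {w j} → Hits D col w j → Hits (v ∷ᴰ D) col w j
      widen (u , Du , adj , e) = u , inj₂ Du , adj , e

  module Greedy (adj? : ∀ u v → Dec (Adj G u v)) where

    firstFit : ∀ {D} → (∀ u → Dec (D u)) → (col : Fin n → ℕ) → (v : Fin n) →
      ∃[ m ] (¬ Hits D col v m × (∀ j → j < m → Hits D col v j))
    firstFit {D} D? col v with maximiser col v
    ... | top , maximal = firstFailure hit? (suc (col top)) tooLarge
      where
        hit? : ∀ j → Dec (Hits D col v j)
        hit? j = any? (λ u → D? u ×-dec adj? v u ×-dec (col u ℕ.≟ j))
        tooLarge : ¬ Hits D col v (suc (col top))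
        tooLarge (u , _ , _ , e) = <-irrefl e (s≤s (maximal u))

    extendBy : ∀ {D col} → (∀ u → Dec (D u)) → IsPartialGrundy D col → (v : Fin n) →
      ∃[ col' ] (IsPartialGrundy (v ∷ᴰ D) col' × Agrees D col col')
    extendBy {D} {col} D? pg v with D? v | firstFit D? col v
    ... | yes Dv | _ = col , absorb Dv pg , λ _ _ → refl
    ... | no v∉D | m , absent , present =
      col [ v ↦ m ] , addVertex pg v∉D fresh present ,
      λ u Du → ↦-away col m (λ { refl → v∉D Du })
      where
        fresh : ∀ u → D u → Adj G v u → col u ≢ m
        fresh u Du adj e = absent (u , Du , adj , e)

    extendAll : ∀ {D col} → (∀ u → Dec (D u)) → IsPartialGrundy D col → (L : List (Fin n)) →
      ∃[ col' ] (IsPartialGrundy (foldr _∷ᴰ_ D L) col' × Agrees D col col')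
    extendAll D? pg [] = _ , pg , λ _ _ → refl
    extendAll D? pg (v ∷ L) with extendAll D? pg L
    ... | col₁ , pg₁ , agree₁ with extendBy (foldr-dec D? L) pg₁ v
    ... | col₂ , pg₂ , agree₂ =
      col₂ , pg₂ , λ u Du → trans (agree₂ u (foldr-⊇ L Du)) (agree₁ u Du)

    complete : ∀ {D col} → (∀ u → Dec (D u)) → IsPartialGrundy D col →
      ∃[ col' ] (IsPartialGrundy (λ _ → ⊤) col' × Agrees D col col')
    complete D? pg with extendAll D? pg (allFin n)
    ... | col' , pg' , agree = col' , total , agree
      where
        everywhere : ∀ u → foldr _∷ᴰ_ _ (allFin n) u
        everywhere u = foldr-∋ (allFin n) (∈-allFin u)
        total : IsPartialGrundy (λ _ → ⊤) col'
        total = record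
          { proper = λ u v _ _ → proper pg' u v (everywhere u) (everywhere v)
          ; grundy = λ v _ j lt → let (u , _ , adj , e) = grundy pg' v (everywhere v) j lt
                                  in u , tt , adj , e }

  grundyColours : ∀ {col} → IsPartialGrundy (λ _ → ⊤) col → (v₀ : Fin n) →
    ∃[ m ] (col v₀ < m × Σ (Fin n → Fin m) (IsGrundy G))
  grundyColours {col} pg v₀ with maximiser col v₀
  ... | top , maximal = suc (col top) , s≤s (maximal v₀) , d , proper′ , onto , grundy′
    where
      d : Fin n → Fin (suc (col top))
      d u = fromℕ< (s≤s (maximal u))
      toℕ-d : ∀ u → toℕ (d u) ≡ col u
      toℕ-d u = toℕ-fromℕ< (s≤s (maximal u))
      d-hits : ∀ {u i} → col u ≡ toℕ i → d u ≡ i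
      d-hits e = toℕ-injective (trans (toℕ-d _) e)

      proper′ : Proper G d
      proper′ u v adj e = proper pg u v tt tt adj (trans (≡.sym (toℕ-d u)) (trans (cong toℕ e) (toℕ-d v)))

      -- colours below the top are seen from the maximiser
      onto : Onto G d
      onto i with m≤n⇒m<n∨m≡n (s≤s⁻¹ (toℕ<n i))
      ... | inj₂ e = top , λ { refl → d-hits (≡.sym e) }
      ... | inj₁ lt with grundy pg top tt (toℕ i) lt
      ... | u , _ , _ , e = u , λ { refl → d-hits e }

      grundy′ : ∀ v (i : Fin (suc (col top))) → i <ᶠ d v → ∃[ u ] (Adj G v u × d u ≡ i)
      grundy′ v i lt with grundy pg v tt (toℕ i) (subst (toℕ i <_) (toℕ-d v) lt)
      ... | u , _ , adj , e = u , adj , d-hits e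

  NeighbourIn : Subset n → Fin n → Set
  NeighbourIn S v = ∃[ s ] (s ∈ S × Adj G v s)

  stable-add : ∀ {S} u → Stable G S → (∀ s → s ∈ S → ¬ Adj G u s) → Stable G (S ∪ ⁅ u ⁆)
  stable-add {S} u stable none v w v∈ w∈ adj = go (x∈p∪q⁻ S ⁅ u ⁆ v∈) (x∈p∪q⁻ S ⁅ u ⁆ w∈)
    where
      go : v ∈ S ⊎ v ∈ ⁅ u ⁆ → w ∈ S ⊎ w ∈ ⁅ u ⁆ → ⊥
      go (inj₁ vS) (inj₁ wS) = stable v w vS wS adj
      go (inj₁ vS) (inj₂ wu) with x∈⁅y⁆⇒x≡y u wu
      ... | refl = none v vS (sym G adj)
      go (inj₂ vu) (inj₁ wS) with x∈⁅y⁆⇒x≡y u vu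
      ... | refl = none w wS adj
      go (inj₂ vu) (inj₂ wu) with x∈⁅y⁆⇒x≡y u vu | x∈⁅y⁆⇒x≡y u wu
      ... | refl | refl = irrefl G adj

  dominating : (∀ u v → Dec (Adj G u v)) → ∀ {S} → MaximalStable G S →
    ∀ u → ¬ u ∈ S → NeighbourIn S u
  dominating adj? {S} (stable , maximal) u u∉S
    with any? (λ s → (s ∈? S) ×-dec adj? u s)
  ... | yes found = found
  ... | no none = ⊥-elim (u∉S (maximal (S ∪ ⁅ u ⁆)
          (stable-add u stable (λ s s∈S adj → none (s , s∈S , adj)))
          (p⊆p∪q ⁅ u ⁆) (x∈p∪q⁺ (inj₂ (x∈⁅x⁆ u)))))

  -- In a complete colouring, a singleton class {φ} is joined to every
  -- other class; so φ has a neighbour in any set containing such a class.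
  singleton-meets : ∀ {k} {c : Fin n → Fin k} → IsComplete G c → ∀ {S} (i : Fin k) →
    (∀ v → c v ≡ i → v ∈ S) → ∀ φ → SingletonClass G c φ → i ≢ c φ → NeighbourIn S φ
  singleton-meets {c = c} (_ , _ , joined) i class⊆S φ single i≢ with joined i (c φ) i≢
  ... | u , v , adj , cu , cv with single v cv
  ... | refl = u , class⊆S u cu , sym G adj

  -- The colouring of an induced P4  a - x - y - b  over a stable set S
  -- whose four vertices each have a neighbour in S: S ↦ 0, a, b ↦ 1,
  -- x ↦ 2, y ↦ 3, built by four applications of addVertex.
  module P4Precolouring {S} (stable : Stable G S) {a x y b : Fin n}
    (a≢x : a ≢ x) (a≢y : a ≢ y) (a≢b : a ≢ b) (x≢y : x ≢ y) (x≢b : x ≢ b) (y≢b : y ≢ b)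
    (ax : Adj G a x) (xy : Adj G x y) (yb : Adj G y b)
    (¬ay : ¬ Adj G a y) (¬xb : ¬ Adj G x b) (¬ab : ¬ Adj G a b)
    (Na : NeighbourIn S a) (Nx : NeighbourIn S x) (Ny : NeighbourIn S y) (Nb : NeighbourIn S b)
    where

    outside : ∀ {v} → NeighbourIn S v → ¬ v ∈ S
    outside (s , s∈S , adj) v∈S = stable _ s v∈S s∈S adj

    ZeroOnS : (Fin n → ℕ) → Set
    ZeroOnS col = ∀ s → s ∈ S → col s ≡ 0
    zero-↦ : ∀ {col v} k → ZeroOnS col → NeighbourIn S v → ZeroOnS (col [ v ↦ k ])
    zero-↦ {col} k z Nv s s∈S = trans (↦-away col k (λ { refl → outside Nv s∈S })) (z s s∈S)

    differs : ∀ {p m k : ℕ} → p ≡ m → m ≢ k → p ≢ k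
    differs e m≢k e' = m≢k (trans (≡.sym e) e')

    hitS : ∀ {D col v} → (∀ {s} → s ∈ S → D s) → ZeroOnS col → NeighbourIn S v → Hits D col v 0
    hitS inS z (s , s∈S , adj) = s , inS s∈S , adj , z s s∈S

    c₀ c₁ c₂ c₃ : Fin n → ℕ
    c₀ _ = 0
    c₁ = c₀ [ a ↦ 1 ]
    c₂ = c₁ [ b ↦ 1 ]
    c₃ = c₂ [ x ↦ 2 ]
    z₁ : ZeroOnS c₁
    z₁ = zero-↦ 1 (λ _ _ → refl) Na
    z₂ : ZeroOnS c₂
    z₂ = zero-↦ 1 z₁ Nb
    z₃ : ZeroOnS c₃
    z₃ = zero-↦ 2 z₂ Nx
    c₂a : c₂ a ≡ 1
    c₂a = trans (↦-away c₁ 1 a≢b) (↦-here c₀ a 1)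
    c₃b : c₃ b ≡ 1
    c₃b = trans (↦-away c₂ 2 (x≢b ∘ ≡.sym)) (↦-here c₁ b 1)

    D₀ D₁ D₂ D₃ : Fin n → Set
    D₀ = _∈ S
    D₁ = a ∷ᴰ D₀
    D₂ = b ∷ᴰ D₁
    D₃ = x ∷ᴰ D₂

    pg₀ : IsPartialGrundy D₀ c₀
    pg₀ = record { proper = λ u v u∈S v∈S adj _ → stable u v u∈S v∈S adj
                 ; grundy = λ _ _ _ () }

    pg₁ : IsPartialGrundy D₁ c₁
    pg₁ = addVertex pg₀ (outside Na) (λ _ _ _ ())
      λ { zero _ → hitS id (λ _ _ → refl) Na ; (suc _) (s≤s ()) }

    pg₂ : IsPartialGrundy D₂ c₂
    pg₂ = addVertex pg₁ [ a≢b ∘ ≡.sym , outside Nb ] fresh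
      λ { zero _ → hitS inj₂ z₁ Nb ; (suc _) (s≤s ()) }
      where
        fresh : ∀ u → D₁ u → Adj G b u → c₁ u ≢ 1
        fresh _ (inj₁ refl) ba = ⊥-elim (¬ab (sym G ba))
        fresh u (inj₂ u∈S) _ = differs (z₁ u u∈S) λ ()

    pg₃ : IsPartialGrundy D₃ c₃
    pg₃ = addVertex pg₂ [ x≢b , [ a≢x ∘ ≡.sym , outside Nx ] ] fresh
      λ { zero _ → hitS (inj₂ ∘ inj₂) z₂ Nx
        ; (suc zero) _ → a , inj₂ (inj₁ refl) , sym G ax , c₂a
        ; (suc (suc _)) (s≤s (s≤s ())) }
      where
        fresh : ∀ u → D₂ u → Adj G x u → c₂ u ≢ 2
        fresh _ (inj₁ refl) xb = ⊥-elim (¬xb xb)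
        fresh _ (inj₂ (inj₁ refl)) _ = differs c₂a λ ()
        fresh u (inj₂ (inj₂ u∈S)) _ = differs (z₂ u u∈S) λ ()

    D₄? : ∀ u → Dec ((y ∷ᴰ D₃) u)
    D₄? = y ∷? (x ∷? (b ∷? (a ∷? (_∈? S))))

    pg₄ : IsPartialGrundy (y ∷ᴰ D₃) (c₃ [ y ↦ 3 ])
    pg₄ = addVertex pg₃ [ x≢y ∘ ≡.sym , [ y≢b , [ a≢y ∘ ≡.sym , outside Ny ] ] ] fresh
      λ { zero _ → hitS (inj₂ ∘ inj₂ ∘ inj₂) z₃ Ny
        ; (suc zero) _ → b , inj₂ (inj₁ refl) , yb , c₃b
        ; (suc (suc zero)) _ → x , inj₁ refl , sym G xy , ↦-here c₂ x 2
        ; (suc (suc (suc _))) (s≤s (s≤s (s≤s ()))) }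
      where
        fresh : ∀ u → D₃ u → Adj G y u → c₃ u ≢ 3
        fresh _ (inj₁ refl) _ = differs (↦-here c₂ x 2) λ ()
        fresh _ (inj₂ (inj₁ refl)) _ = differs c₃b λ ()
        fresh _ (inj₂ (inj₂ (inj₁ refl))) ya = ⊥-elim (¬ay (sym G ya))
        fresh u (inj₂ (inj₂ (inj₂ u∈S))) _ = differs (z₃ u u∈S) λ ()

  p4-grundy : (∀ u v → Dec (Adj G u v)) → ∀ {S} → Stable G S → ∀ {a x y b} →
    InducedP4 G a x y b →
    NeighbourIn S a → NeighbourIn S x → NeighbourIn S y → NeighbourIn S b →
    ∃[ col ] (IsPartialGrundy (λ _ → ⊤) col × col y ≡ 3)
  p4-grundy adj? stable {y = y}
    (a≢x , a≢y , a≢b , x≢y , x≢b , y≢b , ax , xy , yb , ¬ay , ¬xb , ¬ab) Na Nx Ny Nb =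
    finish (Greedy.complete adj? D₄? pg₄)
    where
      open P4Precolouring stable a≢x a≢y a≢b x≢y x≢b y≢b ax xy yb ¬ay ¬xb ¬ab Na Nx Ny Nb
      finish : ∃[ col ] (IsPartialGrundy (λ _ → ⊤) col × Agrees (y ∷ᴰ D₃) (c₃ [ y ↦ 3 ]) col) →
        ∃[ col ] (IsPartialGrundy (λ _ → ⊤) col × col y ≡ 3)
      finish (col , pg , agree) = col , pg , trans (agree y (inj₁ refl)) (↦-here c₃ y 3)

inEitherOrder : ∀ {A : Set} {P : A → Set} {φ₁ φ₂ x y : A} → P φ₁ → P φ₂ →
  (x ≡ φ₁ × y ≡ φ₂ ⊎ x ≡ φ₂ × y ≡ φ₁) → P x × P y
inEitherOrder p₁ p₂ (inj₁ (refl , refl)) = p₁ , p₂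
inEitherOrder p₁ p₂ (inj₂ (refl , refl)) = p₂ , p₁

proposition2 : (h n : ℕ) → 4 ≤ h → n + 2 ≡ 2 * h →
    (G : Graph n) → ChromaticNumber G 3 → GrundyNumber G 3 → AchromaticNumber G h →
    (c : Fin n → Fin h) → IsComplete G c →
    (φ₁ φ₂ : Fin n) → φ₁ ≢ φ₂ → SingletonClass G c φ₁ → SingletonClass G c φ₂ →
    (∀ (i : Fin h) → i ≢ c φ₁ → i ≢ c φ₂ → PairClass G c i) →
    (S : Subset n) → MaximalStable G S →
    (∃[ i ] (i ≢ c φ₁ × i ≢ c φ₂ × (∀ v → c v ≡ i → v ∈ S))) →
    ∀ a x y b → (x ≡ φ₁ × y ≡ φ₂ ⊎ x ≡ φ₂ × y ≡ φ₁) → InducedP4 G a x y b →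
    a ∈ S ⊎ b ∈ S
proposition2 h n _ _ G _ (_ , noLargerGrundy) _ c complete φ₁ φ₂ _ single₁ single₂ _
  S maximalS (i , i≢₁ , i≢₂ , class⊆S) a x y b middle p4 with a ∈? S | b ∈? S
... | yes a∈S | _ = inj₁ a∈S
... | no _ | yes b∈S = inj₂ b∈S
... | no a∉S | no b∉S = ⊥-elim (¬¬-∀Fin (λ u → ¬¬-∀Fin (λ v → ¬¬-excluded-middle)) contradiction)
  where
    middleNeighbours : NeighbourIn G S x × NeighbourIn G S y
    middleNeighbours = inEitherOrder
      (singleton-meets G complete i class⊆S φ₁ single₁ i≢₁)
      (singleton-meets G complete i class⊆S φ₂ single₂ i≢₂) middle

    contradiction : (∀ u v → Dec (Adj G u v)) → ⊥
    contradiction adj? with p4-grundy G adj? (proj₁ maximalS) p4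
      (dominating G adj? maximalS a a∉S) (proj₁ middleNeighbours)
      (proj₂ middleNeighbours) (dominating G adj? maximalS b b∉S)
    ... | col , pg , col-y≡3 with grundyColours G pg y
    ... | m , y<m , grundy = noLargerGrundy m (subst (_< m) col-y≡3 y<m) grundy
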